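{- Let $\sigma=\sigma_1\cdots\sigma_n\in S_n$ satisfy $pmp_{\underline{1}32}(\sigma)=1$, and let $t$ be the unique position at which $\sigma$ has a $\underline{1}32$-match. Then: (1) $\sigma_{t+1}\ge\sigma_t$; (2) the value $\sigma_t+1$ occurs in $\sigma$ to the right of position $t$; (3) $\sigma_{t+1}\neq\sigma_t+1$.
   Context: For $\sigma\in S_n$, $\sigma$ has a $\underline{1}32$-match at position $\ell$ if there exist $j,m$ with $\ell<j<m$ and $\sigma_\ell<\sigma_m<\sigma_j$ (i.e. $\sigma_\ell$ is the first entry of an occurrence of the pattern $132$); $pmp_{\underline{1}32}(\sigma)$ is the number of such positions $\ell$. -}

module Defs where

open import Data.Nat using (ℕ)
open import Data.Fin using (Fin; _<_)
open import Data.Fin.Properties using (any?; _<?_)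
open import Data.Fin.Permutation using (Permutation′; _⟨$⟩ʳ_)
open import Data.Product using (Σ; _×_; ∃)
open import Data.Vec using (count; allFin)
open import Relation.Nullary using (Dec)
open import Relation.Nullary.Decidable using (_×-dec_)

-- σ has a 1̲32-match at position ℓ: there exist j, m with ℓ < j < m and
-- σ ℓ < σ m < σ j.  (Positions and values are 0-based elements of Fin n.)
Match132 : ∀ {n} → Permutation′ n → Fin n → Set
Match132 σ ℓ = ∃ λ j → ∃ λ m →
  (ℓ < j) × (j < m) × ((σ ⟨$⟩ʳ ℓ) < (σ ⟨$⟩ʳ m)) × ((σ ⟨$⟩ʳ m) < (σ ⟨$⟩ʳ j))

match132? : ∀ {n} (σ : Permutation′ n) (ℓ : Fin n) → Dec (Match132 σ ℓ)
match132? σ ℓ = any? λ j → any? λ m →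
  (ℓ <? j) ×-dec ((j <? m) ×-dec (((σ ⟨$⟩ʳ ℓ) <? (σ ⟨$⟩ʳ m)) ×-dec ((σ ⟨$⟩ʳ m) <? (σ ⟨$⟩ʳ j))))

pmp132 : ∀ {n} → Permutation′ n → ℕ
pmp132 {n} σ = count (match132? σ) (allFin n)

{-# OPTIONS --safe #-}
-- If some ℓ < j other than t had σ ℓ ≤ σ m, then (ℓ, j, m) would be a second
-- 1̲32-match.  Hence σ (t+1), which is σ j or lies left of j, exceeds σ t + 1,
-- and the position of the value σ t + 1 ≤ σ m cannot lie left of t.
module Submission where

open import Defs
open import Data.Nat as ℕ using (suc; s≤s; z≤n)
import Data.Nat.Properties as ℕ
open import Data.Fin using (Fin; toℕ; _<_; _≤_; fromℕ<)
open import Data.Fin.Properties using (toℕ-fromℕ<; toℕ-injective; toℕ<n; ≤∧≢⇒<; <⇒≢; <-trans)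
open import Data.Fin.Permutation using (Permutation′; _⟨$⟩ʳ_; _⟨$⟩ˡ_; inverseʳ)
open import Data.Product using (_×_; ∃; _,_)
open import Data.Sum using (inj₁; inj₂)
open import Data.Vec using (Vec; count; _∷_)
open import Data.Vec.Membership.Propositional using (_∈_)
open import Data.Vec.Relation.Unary.Any using (here; there)
open import Data.Vec.Membership.Propositional.Properties using (∈-allFin⁺)
open import Function using (_∘_)
open import Function.Bundles using (Injection)
open import Function.Properties.Inverse using (↔⇒↣)
open import Relation.Nullary using (yes; no; ¬_; contradiction)
open import Relation.Unary using (Pred; Decidable)
open import Relation.Binary.PropositionalEquality using (_≡_; _≢_; refl; sym; trans; cong; subst)

module _ {a p} {A : Set a} {P : Pred A p} (P? : Decidable P) where

  count≥1 : ∀ {n x} {xs : Vec A n} → x ∈ xs → P x → 1 ℕ.≤ count P? xs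
  count≥1 {xs = y ∷ _} x∈ px with P? y | x∈
  ... | yes _  | _           = s≤s z≤n
  ... | no ¬py | here refl   = contradiction px ¬py
  ... | no _   | there x∈xs = count≥1 x∈xs px

  count≡0⇒¬ : ∀ {n x} {xs : Vec A n} → count P? xs ≡ 0 → x ∈ xs → ¬ P x
  count≡0⇒¬ c x∈xs px = ℕ.<⇒≢ (count≥1 x∈xs px) (sym c)

  count≡1⇒unique : ∀ {n x y} {xs : Vec A n} → count P? xs ≡ 1 →
                   x ∈ xs → y ∈ xs → P x → P y → x ≡ y
  count≡1⇒unique {xs = z ∷ _} c x∈ y∈ px py with P? z | x∈ | y∈
  ... | _     | here refl   | here refl   = refl
  ... | yes _ | here refl   | there y∈xs = contradiction py (count≡0⇒¬ (ℕ.suc-injective c) y∈xs)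
  ... | yes _ | there x∈xs | _           = contradiction px (count≡0⇒¬ (ℕ.suc-injective c) x∈xs)
  ... | no ¬pz | here refl  | _           = contradiction px ¬pz
  ... | no ¬pz | _          | here refl   = contradiction py ¬pz
  ... | no _  | there x∈xs | there y∈xs = count≡1⇒unique c x∈xs y∈xs px py

next : ∀ {n} {i j : Fin n} → i < j → Fin n
next {j = j} i<j = fromℕ< (ℕ.≤-<-trans i<j (toℕ<n j))

toℕ-next : ∀ {n} {i j : Fin n} (i<j : i < j) → toℕ (next i<j) ≡ suc (toℕ i)
toℕ-next i<j = toℕ-fromℕ< _

next≢ : ∀ {n} {i j : Fin n} (i<j : i < j) → next i<j ≢ i
next≢ i<j e = ℕ.1+n≢n (trans (sym (toℕ-next i<j)) (cong toℕ e))

match132-unique : ∀ {n} (σ : Permutation′ n) → pmp132 σ ≡ 1 →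
                  ∀ {a b} → Match132 σ a → Match132 σ b → a ≡ b
match132-unique σ pmp≡1 {a} {b} =
  count≡1⇒unique (match132? σ) pmp≡1 (∈-allFin⁺ a) (∈-allFin⁺ b)

module SoleMatch {n} (σ : Permutation′ n) (pmp≡1 : pmp132 σ ≡ 1)
                 {t j m : Fin n} (t<j : t < j) (j<m : j < m)
                 (σt<σm : σ ⟨$⟩ʳ t < σ ⟨$⟩ʳ m) (σm<σj : σ ⟨$⟩ʳ m < σ ⟨$⟩ʳ j) where

  private
    π : Fin n → Fin n
    π = σ ⟨$⟩ʳ_

    π-injective : ∀ {a b} → π a ≡ π b → a ≡ b
    π-injective = Injection.injective (↔⇒↣ σ)

  left-of-j-≤π[m]⇒t : ∀ {ℓ} → ℓ < j → π ℓ ≤ π m → ℓ ≡ t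
  left-of-j-≤π[m]⇒t {ℓ} ℓ<j πℓ≤πm =
    match132-unique σ pmp≡1 (j , m , ℓ<j , j<m , πℓ<πm , σm<σj) (j , m , t<j , j<m , σt<σm , σm<σj)
    where
    πℓ<πm : π ℓ < π m
    πℓ<πm = ≤∧≢⇒< πℓ≤πm (<⇒≢ (<-trans ℓ<j j<m) ∘ π-injective)

  ≤suc-π[t]⇒≤π[m] : ∀ {ℓ} → toℕ (π ℓ) ℕ.≤ suc (toℕ (π t)) → π ℓ ≤ π m
  ≤suc-π[t]⇒≤π[m] πℓ≤1+πt = ℕ.≤-trans πℓ≤1+πt σt<σm

  suc-π[t]<π[next-t] : suc (toℕ (π t)) ℕ.< toℕ (π (next t<j))
  suc-π[t]<π[next-t] = ℕ.≰⇒> (λ πu≤1+πt → π[u]≰π[m] (≤suc-π[t]⇒≤π[m] πu≤1+πt))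
    where
    u : Fin n
    u = next t<j

    π[u]≰π[m] : ¬ (π u ≤ π m)
    π[u]≰π[m] πu≤πm with ℕ.m≤n⇒m<n∨m≡n (subst (ℕ._≤ toℕ j) (sym (toℕ-next t<j)) t<j)
    ... | inj₁ u<j = next≢ t<j (left-of-j-≤π[m]⇒t u<j πu≤πm)
    ... | inj₂ u≡j rewrite toℕ-injective u≡j = ℕ.<⇒≱ σm<σj πu≤πm

  t<π⁻¹[suc-π[t]] : ∀ {p} → toℕ (π p) ≡ suc (toℕ (π t)) → t < p
  t<π⁻¹[suc-π[t]] {p} πp≡1+πt = ℕ.≰⇒> λ p≤t → p≢t (left-of-j-≤π[m]⇒t (ℕ.≤-<-trans p≤t t<j) πp≤πm)
    where
    p≢t : p ≢ t
    p≢t p≡t = ℕ.1+n≢n (trans (sym πp≡1+πt) (cong (toℕ ∘ π) p≡t))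

    πp≤πm : π p ≤ π m
    πp≤πm = ≤suc-π[t]⇒≤π[m] (ℕ.≤-reflexive πp≡1+πt)

lemma5 : ∀ {n} (σ : Permutation′ n) → pmp132 σ ≡ 1 → (t : Fin n) → Match132 σ t →
    (∃ λ u → (toℕ u ≡ suc (toℕ t)) × ((σ ⟨$⟩ʳ t) ≤ (σ ⟨$⟩ʳ u)) × (toℕ (σ ⟨$⟩ʳ u) ≢ suc (toℕ (σ ⟨$⟩ʳ t))))
    × (∃ λ j → (t < j) × (toℕ (σ ⟨$⟩ʳ j) ≡ suc (toℕ (σ ⟨$⟩ʳ t))))
lemma5 σ pmp≡1 t (j , m , t<j , j<m , σt<σm , σm<σj) =
  (next t<j , toℕ-next t<j , ℕ.<⇒≤ (ℕ.<-trans (ℕ.n<1+n _) suc-π[t]<π[next-t]) , ℕ.>⇒≢ suc-π[t]<π[next-t])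
  , (p , t<π⁻¹[suc-π[t]] σp≡1+σt , σp≡1+σt)
  where
  open SoleMatch σ pmp≡1 t<j j<m σt<σm σm<σj

  p : Fin _
  p = σ ⟨$⟩ˡ next σt<σm

  σp≡1+σt : toℕ (σ ⟨$⟩ʳ p) ≡ suc (toℕ (σ ⟨$⟩ʳ t))
  σp≡1+σt = trans (cong toℕ (inverseʳ σ)) (toℕ-next σt<σm)
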